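{- Let $n\ge 2$ and $G_n\in HL_n$. For any $X\subseteq V(G_n)$ with $|X|=g$, we have $|E_X|\ge ng-2e_g$. Moreover, $n(g+1)-e_{g+1}>ng-e_g$ for every integer $1\le g\le 2^{\lceil n/2\rceil}$, i.e. the function $g\mapsto ng-e_g$ is strictly increasing for $g\le 2^{\lceil n/2\rceil}$.
   Context: HL-networks are defined recursively: $HL_0=\{K_1\}$ and $HL_n=\{G_{n-1}\oplus G^*_{n-1} : G_{n-1},G^*_{n-1}\in HL_{n-1}\}$, where $G_{n-1}\oplus G^*_{n-1}$ denotes any graph obtained from the disjoint union of $G_{n-1}$ and $G^*_{n-1}$ by adding a perfect matching between their vertex sets. Each $G_n\in HL_n$ is $n$-regular with $2^n$ vertices. $e_g$ denotes the maximum number of edges of a subgraph of $G_n$ induced by $g$ vertices. For $X\subseteq V(G_n)$, $E_X$ is the set of edges of $G_n$ having exactly one endpoint in $X$. -}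

module Defs where

open import Data.Nat using (ℕ; zero; suc; _+_; _*_; _⊔_)
open import Data.Bool using (Bool; true; false; if_then_else_; _∧_; _xor_)
open import Data.Fin using (Fin; splitAt; _<?_; _≟_)
open import Data.Fin.Subset using (Subset; ∣_∣)
open import Data.Fin.Permutation using (Permutation′; _⟨$⟩ʳ_)
open import Data.Vec using (Vec; []; _∷_; lookup)
open import Data.List using (List; []; _∷_; map; allFin; foldr; _++_)
open import Data.Nat.ListAction using (sum)
open import Data.Sum using (inj₁; inj₂)
open import Relation.Nullary using (does)
open import Relation.Binary.PropositionalEquality using (_≡_)

-- number of vertices of an HL_n graph: pow2 n = 2^n (defined so that
-- pow2 (suc n) = pow2 n + pow2 n definitionally)
pow2 : ℕ → ℕ
pow2 zero    = 1
pow2 (suc n) = pow2 n + pow2 n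

Graph : ℕ → Set
Graph N = Fin N → Fin N → Bool

K1 : Graph 1
K1 _ _ = false

-- G ⊕_π H : disjoint union of G (vertices Fin m, first block) and H (second block)
-- plus the perfect matching u ~ π(u) between the two vertex sets
-- (every perfect matching between the two blocks is of this form for some bijection π)
joinHL : ∀ {m} → Graph m → Graph m → Permutation′ m → Graph (m + m)
joinHL {m} G H π u v with splitAt m u | splitAt m v
... | inj₁ a | inj₁ b = G a b
... | inj₂ a | inj₂ b = H a b
... | inj₁ a | inj₂ b = does ((π ⟨$⟩ʳ a) ≟ b)
... | inj₂ a | inj₁ b = does ((π ⟨$⟩ʳ b) ≟ a)

-- membership of a graph in HL_n (adjacency taken up to pointwise equality)
data HL : (n : ℕ) → Graph (pow2 n) → Set where
  hl0   : ∀ (A : Graph 1) → (∀ u v → A u v ≡ K1 u v) → HL zero A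
  hlsuc : ∀ {n} {G H : Graph (pow2 n)} → HL n G → HL n H →
          (π : Permutation′ (pow2 n)) →
          (A : Graph (pow2 (suc n))) → (∀ u v → A u v ≡ joinHL G H π u v) →
          HL (suc n) A

pairCount : ∀ {N} → (Fin N → Fin N → Bool) → ℕ
pairCount {N} P =
  sum (map (λ u → sum (map (λ v → if does (u <? v) ∧ P u v then 1 else 0) (allFin N))) (allFin N))

inducedEdges : ∀ {N} → Graph N → Subset N → ℕ
inducedEdges G X = pairCount (λ u v → lookup X u ∧ lookup X v ∧ G u v)

boundary : ∀ {N} → Graph N → Subset N → ℕ
boundary G X = pairCount (λ u v → (lookup X u xor lookup X v) ∧ G u v)

allSubsets : (N : ℕ) → List (Subset N)
allSubsets zero    = [] ∷ []
allSubsets (suc N) = map (true ∷_) (allSubsets N) ++ map (false ∷_) (allSubsets N)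

-- e_g : maximum number of edges of a subgraph of G induced by g vertices
-- (0 if there are no g-subsets)
maxEdges : ∀ {N} → Graph N → ℕ → ℕ
maxEdges {N} G g =
  foldr _⊔_ 0 (map (λ X → if does (∣ X ∣ Data.Nat.≟ g) then inducedEdges G X else 0) (allSubsets N))

module Submission where

-- Counting ordered pairs of adjacent vertices in an n-regular simple graph gives the
-- handshake identity n |X| = 2 e(X) + |E_X|, hence the first inequality.  HL-graphs are
-- connected, so a set X of g + 1 < 2^n vertices is left by some edge uv with u ∈ X; then
-- e(X) = e(X - u) + deg_{X - u}(u) and deg_{X - u}(u) < n because v ∉ X, so
-- e_{g+1} < n + e_g.  Finally g + 1 ≤ 2^⌈n/2⌉ + 1 < 2^n for n ≥ 2.

open import Defs
open import Data.Nat.Properties hiding (_≟_; _<?_)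
open import Algebra.Properties.Semiring.Sum +-*-semiring
  using (sum; sum-syntax; sum-cong-≗; sum-remove; sum-replicate-zero; ∑-distrib-+; ∑-comm; ∑-permute; *-distribʳ-sum)
import Data.Bool as Bool
open import Data.Bool using (Bool; true; false; if_then_else_; _∧_; _xor_; not)
open import Data.Bool.Properties using (∧-comm; ∧-zeroʳ; xor-same; xor-comm)
open import Data.Fin using (Fin; zero; suc; splitAt; _↑ˡ_; _↑ʳ_; _<?_; _≟_; punchIn)
import Data.Fin.Properties as Fin
open import Data.Fin.Permutation using (Permutation′; _⟨$⟩ʳ_; _⟨$⟩ˡ_; inverseʳ)
open import Data.Fin.Subset using (Subset; ∣_∣)
open import Data.List using (map; tabulate; allFin)
open import Data.List.Properties using (foldr-preservesᵇ; foldr-preservesᵒ)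
open import Data.List.Relation.Unary.Any using (here)
import Data.List.Relation.Unary.All as All
import Data.List.Relation.Unary.All.Properties as All
open import Data.List.Membership.Propositional using (_∈_; lose)
open import Data.List.Membership.Propositional.Properties using (∈-map⁺; ∈-++⁺ˡ; ∈-++⁺ʳ)
import Data.Nat.ListAction as List
import Data.Nat as ℕ
open import Data.Nat using (ℕ; zero; suc; _+_; _*_; _^_; _≤_; _<_; _⊔_; ⌈_/2⌉; z≤n; s≤s; s≤s⁻¹; z<s)
open import Data.Product using (_×_; _,_; ∃; ∃₂; proj₂)
open import Data.Sum using (inj₁; inj₂; [_,_])
open import Data.Vec using ([]; _∷_; lookup)
import Data.Vec as Vec
open import Data.Vec.Properties using (lookup∘tabulate)
open import Data.Nat.Tactic.RingSolver using (solve-∀)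
open import Function using (_∘_; flip)
open import Relation.Binary.Definitions using (tri<; tri≈; tri>)
open import Relation.Binary.PropositionalEquality using (_≡_; _≢_; refl; sym; trans; cong; cong₂; subst; module ≡-Reasoning)
open import Relation.Nullary using (does; yes; no; contradiction)
open import Relation.Nullary.Decidable using (dec-true; dec-false)

𝟙 : Bool → ℕ
𝟙 b = if b then 1 else 0

count : ∀ {N} → (Fin N → Bool) → ℕ
count {N} P = ∑[ i < N ] 𝟙 (P i)

listSum-tabulate : ∀ {A : Set} {N} (f : A → ℕ) (g : Fin N → A) →
  List.sum (map f (tabulate g)) ≡ ∑[ i < N ] f (g i)
listSum-tabulate {N = zero}  f g = refl
listSum-tabulate {N = suc N} f g = cong (f (g zero) +_) (listSum-tabulate f (g ∘ suc))

∑-pick : ∀ {N} (f : Fin N → ℕ) u → (∀ a → a ≢ u → f a ≡ 0) → ∑[ a < N ] f a ≡ f u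
∑-pick {suc N} f u zero-off = begin
  sum f                                ≡⟨ sum-remove f ⟩
  f u + ∑[ j < N ] f (punchIn u j)     ≡⟨ cong (f u +_) (sum-cong-≗ (λ j → zero-off _ (Fin.punchInᵢ≢i u j))) ⟩
  f u + ∑[ j < N ] 0                   ≡⟨ cong (f u +_) (sum-replicate-zero N) ⟩
  f u + 0                              ≡⟨ +-identityʳ (f u) ⟩
  f u                                  ∎
  where open ≡-Reasoning

∑-↑ˡ↑ʳ : ∀ m n (f : Fin (m + n) → ℕ) → sum f ≡ ∑[ i < m ] f (i ↑ˡ n) + ∑[ j < n ] f (m ↑ʳ j)
∑-↑ˡ↑ʳ zero    n f = refl
∑-↑ˡ↑ʳ (suc m) n f = trans (cong (f zero +_) (∑-↑ˡ↑ʳ m n (f ∘ suc))) (sym (+-assoc (f zero) _ _))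

count-≟ʳ : ∀ {N} (c : Fin N) → count (λ b → does (c ≟ b)) ≡ 1
count-≟ʳ c = trans (∑-pick _ c (λ b b≢c → cong 𝟙 (dec-false (c ≟ b) (b≢c ∘ sym)))) (cong 𝟙 (dec-true (c ≟ c) refl))

∑≥term : ∀ {N} (f : Fin N → ℕ) i → f i ≤ sum f
∑≥term {suc N} f i = ≤-trans (m≤m+n (f i) _) (≤-reflexive (sym (sum-remove f)))

count-at : ∀ {N} (P : Fin N → Bool) u → P u ≡ true → count (λ a → P a ∧ does (a ≟ u)) ≡ 1
count-at P u Pu = trans (∑-pick _ u off) on
  where
  off : ∀ a → a ≢ u → 𝟙 (P a ∧ does (a ≟ u)) ≡ 0
  off a a≢u rewrite dec-false (a ≟ u) a≢u | ∧-zeroʳ (P a) = refl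
  on : 𝟙 (P u ∧ does (u ≟ u)) ≡ 1
  on rewrite Pu | dec-true (u ≟ u) refl = refl

∣∣≡count : ∀ {N} (X : Subset N) → ∣ X ∣ ≡ count (lookup X)
∣∣≡count []          = refl
∣∣≡count (true ∷ X)  = cong suc (∣∣≡count X)
∣∣≡count (false ∷ X) = ∣∣≡count X

𝟙-split : ∀ p q → 𝟙 p ≡ 𝟙 (p ∧ q) + 𝟙 (p ∧ not q)
𝟙-split false q     = refl
𝟙-split true  true  = refl
𝟙-split true  false = refl

count-split : ∀ {N} (P Q : Fin N → Bool) →
  count P ≡ count (λ i → P i ∧ Q i) + count (λ i → P i ∧ not (Q i))
count-split P Q = trans (sum-cong-≗ (λ i → 𝟙-split (P i) (Q i)))
  (∑-distrib-+ (λ i → 𝟙 (P i ∧ Q i)) (λ i → 𝟙 (P i ∧ not (Q i))))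

∣X∣>0⇒∃ : ∀ {N} (X : Subset N) → 0 < ∣ X ∣ → ∃ λ u → lookup X u ≡ true
∣X∣>0⇒∃ (true ∷ X)  _   = zero , refl
∣X∣>0⇒∃ (false ∷ X) pos = let u , Xu = ∣X∣>0⇒∃ X pos in suc u , Xu

∣X∣<N⇒∃ : ∀ {N} (X : Subset N) → ∣ X ∣ < N → ∃ λ v → lookup X v ≡ false
∣X∣<N⇒∃ (false ∷ X) _  = zero , refl
∣X∣<N⇒∃ (true ∷ X)  lt = let v , Xv = ∣X∣<N⇒∃ X (s≤s⁻¹ lt) in suc v , Xv

arcCount : ∀ {N} → (Fin N → Fin N → Bool) → ℕ
arcCount {N} R = ∑[ u < N ] count (R u)

arcCount-cong : ∀ {N} {R R′ : Fin N → Fin N → Bool} → (∀ u v → R u v ≡ R′ u v) → arcCount R ≡ arcCount R′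
arcCount-cong R≗R′ = sum-cong-≗ (λ u → sum-cong-≗ (λ v → cong 𝟙 (R≗R′ u v)))

arcCount-+ : ∀ {N} {R R₁ R₂ : Fin N → Fin N → Bool} → (∀ u v → 𝟙 (R u v) ≡ 𝟙 (R₁ u v) + 𝟙 (R₂ u v)) →
  arcCount R ≡ arcCount R₁ + arcCount R₂
arcCount-+ {R₁ = R₁} {R₂} split =
  trans (sum-cong-≗ (λ u → trans (sum-cong-≗ (split u)) (∑-distrib-+ (λ v → 𝟙 (R₁ u v)) (λ v → 𝟙 (R₂ u v)))))
        (∑-distrib-+ (count ∘ R₁) (count ∘ R₂))

arcCount-flip : ∀ {N} (R : Fin N → Fin N → Bool) → arcCount (flip R) ≡ arcCount R
arcCount-flip R = ∑-comm (λ v u → 𝟙 (R u v))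

pairCount≡arcCount : ∀ {N} (R : Fin N → Fin N → Bool) → pairCount R ≡ arcCount (λ u v → does (u <? v) ∧ R u v)
pairCount≡arcCount {N} R =
  trans (listSum-tabulate (λ u → List.sum (map (λ v → 𝟙 (does (u <? v) ∧ R u v)) (allFin N))) (λ u → u))
  (sum-cong-≗ (λ u → listSum-tabulate (λ v → 𝟙 (does (u <? v) ∧ R u v)) (λ v → v)))

𝟙-trichotomy : ∀ {N} (R : Fin N → Fin N → Bool) u v → R u u ≡ false →
  𝟙 (R u v) ≡ 𝟙 (does (u <? v) ∧ R u v) + 𝟙 (does (v <? u) ∧ R u v)
𝟙-trichotomy R u v Ruu≡false with Fin.<-cmp u v
... | tri< u<v _ v≮u rewrite dec-true (u <? v) u<v | dec-false (v <? u) v≮u = sym (+-identityʳ _)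
... | tri> u≮v _ v<u rewrite dec-false (u <? v) u≮v | dec-true (v <? u) v<u = refl
... | tri≈ u≮u refl _ rewrite dec-false (u <? u) u≮u | Ruu≡false = refl

arcCount-loopless : ∀ {N} (R : Fin N → Fin N → Bool) → (∀ u → R u u ≡ false) →
  arcCount R ≡ pairCount R + pairCount (flip R)
arcCount-loopless R loopless = begin
  arcCount R
    ≡⟨ arcCount-+ (λ u v → 𝟙-trichotomy R u v (loopless u)) ⟩
  arcCount (λ u v → does (u <? v) ∧ R u v) + arcCount (λ u v → does (v <? u) ∧ R u v)
    ≡⟨ cong (arcCount (λ u v → does (u <? v) ∧ R u v) +_) (arcCount-flip (λ u v → does (u <? v) ∧ R v u)) ⟩
  arcCount (λ u v → does (u <? v) ∧ R u v) + arcCount (λ u v → does (u <? v) ∧ R v u)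
    ≡⟨ sym (cong₂ _+_ (pairCount≡arcCount R) (pairCount≡arcCount (flip R))) ⟩
  pairCount R + pairCount (flip R)                                           ∎
  where open ≡-Reasoning

arcCount-symmetric : ∀ {N} (R : Fin N → Fin N → Bool) → (∀ u → R u u ≡ false) → (∀ u v → R u v ≡ R v u) →
  arcCount R ≡ 2 * pairCount R
arcCount-symmetric R loopless symmetric = begin
  arcCount R                        ≡⟨ arcCount-loopless R loopless ⟩
  pairCount R + pairCount (flip R)  ≡⟨ cong (pairCount R +_) flip-invariant ⟩
  pairCount R + pairCount R         ≡⟨ cong (pairCount R +_) (sym (+-identityʳ _)) ⟩
  2 * pairCount R                   ∎
  where
  open ≡-Reasoning
  flip-invariant : pairCount (flip R) ≡ pairCount R
  flip-invariant = trans (pairCount≡arcCount (flip R))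
    (trans (arcCount-cong (λ u v → cong (does (u <? v) ∧_) (symmetric v u))) (sym (pairCount≡arcCount R)))

record IsSimple {N} (G : Graph N) : Set where
  field
    loopless  : ∀ u → G u u ≡ false
    symmetric : ∀ u v → G u v ≡ G v u

Regular : ∀ {N} → ℕ → Graph N → Set
Regular d G = ∀ u → count (G u) ≡ d

Connected : ∀ {N} → Graph N → Set
Connected {N} G = ∀ (S : Fin N → Bool) {s t} → S s ≡ true → S t ≡ false →
  ∃₂ λ u v → S u ≡ true × S v ≡ false × G u v ≡ true

arcs : ∀ {N} → Graph N → (Fin N → Bool) → (Fin N → Bool) → ℕ
arcs G S T = arcCount (λ u v → S u ∧ T v ∧ G u v)

degreeIn : ∀ {N} → Graph N → (Fin N → Bool) → Fin N → ℕ
degreeIn G T u = count (λ v → T v ∧ G u v)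

module _ {N} {G : Graph N} where

  arcs-cong : ∀ {S S′ T T′ : Fin N → Bool} → (∀ u → S u ≡ S′ u) → (∀ v → T v ≡ T′ v) →
    arcs G S T ≡ arcs G S′ T′
  arcs-cong S≗S′ T≗T′ = arcCount-cong (λ u v → cong₂ (λ s t → s ∧ t ∧ G u v) (S≗S′ u) (T≗T′ v))

  arcs-swap : IsSimple G → ∀ (S T : Fin N → Bool) u v → (S u ∧ T v ∧ G u v) ≡ (T v ∧ S u ∧ G v u)
  arcs-swap simple S T u v with S u | T v
  ... | true  | true  = IsSimple.symmetric simple u v
  ... | true  | false = refl
  ... | false | true  = refl
  ... | false | false = refl

  arcs-comm : IsSimple G → ∀ (S T : Fin N → Bool) → arcs G S T ≡ arcs G T S
  arcs-comm simple S T = trans (arcCount-cong (arcs-swap simple S T)) (arcCount-flip (λ u v → T u ∧ S v ∧ G u v))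

  arcs-splitˡ : ∀ (S Q T : Fin N → Bool) → arcs G S T ≡ arcs G (λ u → S u ∧ Q u) T + arcs G (λ u → S u ∧ not (Q u)) T
  arcs-splitˡ S Q T = arcCount-+ (λ u v → split (S u) (Q u) (T v ∧ G u v))
    where
    split : ∀ s q r → 𝟙 (s ∧ r) ≡ 𝟙 ((s ∧ q) ∧ r) + 𝟙 ((s ∧ not q) ∧ r)
    split false q     r = refl
    split true  true  r = sym (+-identityʳ _)
    split true  false r = refl

  arcs-splitʳ : ∀ (S T Q : Fin N → Bool) → arcs G S T ≡ arcs G S (λ v → T v ∧ Q v) + arcs G S (λ v → T v ∧ not (Q v))
  arcs-splitʳ S T Q = arcCount-+ (λ u v → split (S u) (T v) (Q v) (G u v))
    where
    split : ∀ s t q g → 𝟙 (s ∧ t ∧ g) ≡ 𝟙 (s ∧ (t ∧ q) ∧ g) + 𝟙 (s ∧ (t ∧ not q) ∧ g)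
    split false t     q     g = refl
    split true  false q     g = refl
    split true  true  true  g = sym (+-identityʳ _)
    split true  true  false g = refl

  arcs-from-vertex : ∀ (S T : Fin N → Bool) u → S u ≡ true → arcs G (λ a → S a ∧ does (a ≟ u)) T ≡ degreeIn G T u
  arcs-from-vertex S T u Su = trans (∑-pick _ u off) on
    where
    off : ∀ a → a ≢ u → count (λ v → (S a ∧ does (a ≟ u)) ∧ T v ∧ G a v) ≡ 0
    off a a≢u rewrite dec-false (a ≟ u) a≢u | ∧-zeroʳ (S a) = sum-replicate-zero N
    on : count (λ v → (S u ∧ does (u ≟ u)) ∧ T v ∧ G u v) ≡ degreeIn G T u
    on rewrite Su | dec-true (u ≟ u) refl = refl

  arcs-to-everything : ∀ {d} → Regular d G → ∀ (S : Fin N → Bool) → arcs G S (λ _ → true) ≡ d * count S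
  arcs-to-everything {d} regular S = begin
    arcs G S (λ _ → true)       ≡⟨ sum-cong-≗ row ⟩
    ∑[ u < N ] (𝟙 (S u) * d)    ≡⟨ sym (*-distribʳ-sum d (𝟙 ∘ S)) ⟩
    count S * d                 ≡⟨ *-comm (count S) d ⟩
    d * count S                 ∎
    where
    open ≡-Reasoning
    row : ∀ u → count (λ v → S u ∧ G u v) ≡ 𝟙 (S u) * d
    row u with S u
    ... | true  = trans (regular u) (sym (+-identityʳ d))
    ... | false = sum-replicate-zero N

  arcs-inside : IsSimple G → (X : Subset N) → arcs G (lookup X) (lookup X) ≡ 2 * inducedEdges G X
  arcs-inside simple X = arcCount-symmetric _ loopless (arcs-swap simple χ χ)
    where
    χ = lookup X
    loopless : ∀ u → (χ u ∧ χ u ∧ G u u) ≡ false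
    loopless u rewrite IsSimple.loopless simple u with χ u
    ... | true  = refl
    ... | false = refl

  arcs-boundary : IsSimple G → (X : Subset N) → arcs G (lookup X) (not ∘ lookup X) ≡ boundary G X
  arcs-boundary simple X = *-cancelˡ-≡ _ _ 2 (begin
    2 * arcs G χ (not ∘ χ)                     ≡⟨ cong (arcs G χ (not ∘ χ) +_) (+-identityʳ _) ⟩
    arcs G χ (not ∘ χ) + arcs G χ (not ∘ χ)    ≡⟨ cong (arcs G χ (not ∘ χ) +_) (arcs-comm simple χ (not ∘ χ)) ⟩
    arcs G χ (not ∘ χ) + arcs G (not ∘ χ) χ    ≡⟨ sym (arcCount-+ (λ u v → split (χ u) (χ v) (G u v))) ⟩
    arcCount crossing                           ≡⟨ arcCount-symmetric crossing loopless symmetric ⟩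
    2 * boundary G X                            ∎)
    where
    open ≡-Reasoning
    χ = lookup X
    crossing : Fin N → Fin N → Bool
    crossing u v = (χ u xor χ v) ∧ G u v
    split : ∀ x y g → 𝟙 ((x xor y) ∧ g) ≡ 𝟙 (x ∧ not y ∧ g) + 𝟙 (not x ∧ y ∧ g)
    split true  true  g = refl
    split true  false g = sym (+-identityʳ _)
    split false true  g = refl
    split false false g = refl
    loopless : ∀ u → crossing u u ≡ false
    loopless u rewrite xor-same (χ u) = refl
    symmetric : ∀ u v → crossing u v ≡ crossing v u
    symmetric u v rewrite xor-comm (χ u) (χ v) | IsSimple.symmetric simple u v = refl

  handshake : ∀ {d} → IsSimple G → Regular d G → (X : Subset N) → d * ∣ X ∣ ≡ 2 * inducedEdges G X + boundary G X
  handshake {d} simple regular X = begin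
    d * ∣ X ∣                                  ≡⟨ cong (d *_) (∣∣≡count X) ⟩
    d * count χ                                ≡⟨ sym (arcs-to-everything regular χ) ⟩
    arcs G χ (λ _ → true)                      ≡⟨ arcs-splitʳ χ (λ _ → true) χ ⟩
    arcs G χ χ + arcs G χ (not ∘ χ)            ≡⟨ cong₂ _+_ (arcs-inside simple X) (arcs-boundary simple X) ⟩
    2 * inducedEdges G X + boundary G X        ∎
    where
    open ≡-Reasoning
    χ = lookup X

  degreeIn-< : ∀ {d} → Regular d G → (T : Fin N → Bool) {u v : Fin N} → T v ≡ false → G u v ≡ true → degreeIn G T u < d
  degreeIn-< {d} regular T {u} {v} Tv Guv = begin-strict
    degreeIn G T u                       <⟨ m<m+n _ leaving-T ⟩
    degreeIn G T u + count leaving       ≡⟨ cong (_+ count leaving) (sum-cong-≗ (λ w → cong 𝟙 (∧-comm (T w) (G u w)))) ⟩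
    count staying + count leaving        ≡⟨ sym (count-split (G u) T) ⟩
    count (G u)                          ≡⟨ regular u ⟩
    d                                    ∎
    where
    open ≤-Reasoning
    staying leaving : Fin N → Bool
    staying w = G u w ∧ T w
    leaving w = G u w ∧ not (T w)
    leaving-T : 0 < count leaving
    leaving-T = subst (_≤ count leaving) v-leaves (∑≥term _ v)
      where
      v-leaves : 𝟙 (G u v ∧ not (T v)) ≡ 1
      v-leaves rewrite Guv | Tv = refl

delete : ∀ {N} → Subset N → Fin N → Subset N
delete X u = Vec.tabulate (λ w → lookup X w ∧ not (does (w ≟ u)))

∣delete∣ : ∀ {N} (X : Subset N) {u} → lookup X u ≡ true → ∣ X ∣ ≡ suc ∣ delete X u ∣
∣delete∣ X {u} Xu = begin
  ∣ X ∣                                     ≡⟨ ∣∣≡count X ⟩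
  count χ                                   ≡⟨ count-split χ (λ w → does (w ≟ u)) ⟩
  count (λ w → χ w ∧ does (w ≟ u)) + count ψ ≡⟨ cong (_+ count ψ) (count-at χ u Xu) ⟩
  suc (count ψ)                             ≡⟨ cong suc (sum-cong-≗ (λ w → cong 𝟙 (sym (lookup∘tabulate ψ w)))) ⟩
  suc (count (lookup (delete X u)))         ≡⟨ cong suc (sym (∣∣≡count (delete X u))) ⟩
  suc ∣ delete X u ∣                        ∎
  where
  open ≡-Reasoning
  χ ψ : _ → Bool
  χ = lookup X
  ψ w = χ w ∧ not (does (w ≟ u))

module _ {N} {G : Graph N} (simple : IsSimple G) where

  inducedEdges-delete : (X : Subset N) {u : Fin N} → lookup X u ≡ true →
    2 * inducedEdges G X ≡ degreeIn G (lookup X) u + (degreeIn G (lookup (delete X u)) u + 2 * inducedEdges G (delete X u))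
  inducedEdges-delete X {u} Xu = begin
    2 * inducedEdges G X                         ≡⟨ sym (arcs-inside simple X) ⟩
    arcs G χ χ                                   ≡⟨ arcs-splitˡ χ at-u χ ⟩
    arcs G (λ a → χ a ∧ at-u a) χ + arcs G ψ χ   ≡⟨ cong₂ _+_ (arcs-from-vertex χ χ u Xu) (arcs-comm simple ψ χ) ⟩
    degreeIn G χ u + arcs G χ ψ                  ≡⟨ cong (degreeIn G χ u +_) (arcs-splitˡ χ at-u ψ) ⟩
    degreeIn G χ u + (arcs G (λ a → χ a ∧ at-u a) ψ + arcs G ψ ψ)
      ≡⟨ cong (degreeIn G χ u +_) (cong₂ _+_ (arcs-from-vertex χ ψ u Xu) (arcs-cong ψ≗ψ ψ≗ψ)) ⟩
    degreeIn G χ u + (degreeIn G ψ u + arcs G (lookup Y) (lookup Y))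
      ≡⟨ cong (λ k → degreeIn G χ u + (k + arcs G (lookup Y) (lookup Y)))
              (sum-cong-≗ (λ v → cong (λ b → 𝟙 (b ∧ G u v)) (ψ≗ψ v))) ⟩
    degreeIn G χ u + (degreeIn G (lookup Y) u + arcs G (lookup Y) (lookup Y))
      ≡⟨ cong (λ k → degreeIn G χ u + (degreeIn G (lookup Y) u + k)) (arcs-inside simple Y) ⟩
    degreeIn G χ u + (degreeIn G (lookup Y) u + 2 * inducedEdges G Y) ∎
    where
    open ≡-Reasoning
    χ ψ at-u : Fin N → Bool
    χ = lookup X
    at-u a = does (a ≟ u)
    ψ a = χ a ∧ not (at-u a)
    Y = delete X u
    ψ≗ψ : ∀ a → ψ a ≡ lookup Y a
    ψ≗ψ a = sym (lookup∘tabulate ψ a)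

  inducedEdges-delete-< : ∀ {d} → Regular d G → (X : Subset N) {u v : Fin N} →
    lookup X u ≡ true → lookup X v ≡ false → G u v ≡ true → inducedEdges G X < d + inducedEdges G (delete X u)
  inducedEdges-delete-< {d} regular X {u} {v} Xu Xv Guv = *-cancelˡ-< 2 _ _ (begin-strict
    2 * inducedEdges G X                                                  ≡⟨ inducedEdges-delete X Xu ⟩
    degreeIn G (lookup X) u + (degreeIn G (lookup Y) u + 2 * inducedEdges G Y)
      <⟨ +-mono-<-≤ (degreeIn-< regular (lookup X) Xv Guv) (+-monoˡ-≤ _ (<⇒≤ (degreeIn-< regular (lookup Y) Yv Guv))) ⟩
    d + (d + 2 * inducedEdges G Y)                                        ≡⟨ regroup d (inducedEdges G Y) ⟩
    2 * (d + inducedEdges G Y)                                            ∎)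
    where
    open ≤-Reasoning
    Y = delete X u
    Yv : lookup Y v ≡ false
    Yv rewrite lookup∘tabulate (λ w → lookup X w ∧ not (does (w ≟ u))) v | Xv = refl
    regroup : ∀ d e → d + (d + 2 * e) ≡ 2 * (d + e)
    regroup = solve-∀

∈-allSubsets : ∀ {N} (X : Subset N) → X ∈ allSubsets N
∈-allSubsets []                   = here refl
∈-allSubsets (true ∷ X)           = ∈-++⁺ˡ (∈-map⁺ (true ∷_) (∈-allSubsets X))
∈-allSubsets {suc N} (false ∷ X)  = ∈-++⁺ʳ (map (true ∷_) (allSubsets N)) (∈-map⁺ (false ∷_) (∈-allSubsets X))

module _ {N} (G : Graph N) where

  inducedEdges≤maxEdges : (X : Subset N) → inducedEdges G X ≤ maxEdges G ∣ X ∣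
  inducedEdges≤maxEdges X =
    foldr-preservesᵒ {P = inducedEdges G X ≤_} {f = _⊔_} (λ x y → [ m≤n⇒m≤n⊔o y , m≤n⇒m≤o⊔n x ]) 0 _
    (inj₂ (lose (∈-map⁺ candidate (∈-allSubsets X)) (≤-reflexive (sym size-matches))))
    where
    candidate : Subset N → ℕ
    candidate Y = if does (∣ Y ∣ ℕ.≟ ∣ X ∣) then inducedEdges G Y else 0
    size-matches : candidate X ≡ inducedEdges G X
    size-matches rewrite dec-true (∣ X ∣ ℕ.≟ ∣ X ∣) refl = refl

  maxEdges-< : ∀ {g b} → 0 < b → (∀ X → ∣ X ∣ ≡ g → inducedEdges G X < b) → maxEdges G g < b
  maxEdges-< {g} {b} 0<b bounded =
    foldr-preservesᵇ {P = _< b} {f = _⊔_} ⊔-lub 0<b (All.map⁺ (All.universal candidate-< (allSubsets N)))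
    where
    candidate-< : ∀ X → (if does (∣ X ∣ ℕ.≟ g) then inducedEdges G X else 0) < b
    candidate-< X with ∣ X ∣ ℕ.≟ g
    ... | yes ∣X∣≡g rewrite dec-true (∣ X ∣ ℕ.≟ g) ∣X∣≡g = bounded X ∣X∣≡g
    ... | no ∣X∣≢g  rewrite dec-false (∣ X ∣ ℕ.≟ g) ∣X∣≢g = 0<b

module _ {N} {G : Graph N} {d} (simple : IsSimple G) (regular : Regular d G) where

  boundary+maxEdges-≥ : (X : Subset N) → d * ∣ X ∣ ≤ boundary G X + 2 * maxEdges G ∣ X ∣
  boundary+maxEdges-≥ X = begin
    d * ∣ X ∣                              ≡⟨ handshake simple regular X ⟩
    2 * inducedEdges G X + boundary G X    ≡⟨ +-comm _ (boundary G X) ⟩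
    boundary G X + 2 * inducedEdges G X    ≤⟨ +-monoʳ-≤ (boundary G X) (*-monoʳ-≤ 2 (inducedEdges≤maxEdges G X)) ⟩
    boundary G X + 2 * maxEdges G ∣ X ∣    ∎
    where open ≤-Reasoning

  maxEdges-suc-< : Connected G → 0 < d → ∀ {g} → suc g < N → maxEdges G (suc g) < d + maxEdges G g
  maxEdges-suc-< connected 0<d {g} sg<N = maxEdges-< G (≤-trans 0<d (m≤m+n d _)) bound
    where
    bound : ∀ X → ∣ X ∣ ≡ suc g → inducedEdges G X < d + maxEdges G g
    bound X ∣X∣≡sg
      with _ , Xs ← ∣X∣>0⇒∃ X (subst (0 <_) (sym ∣X∣≡sg) z<s)
      with _ , Xt ← ∣X∣<N⇒∃ X (subst (_< N) (sym ∣X∣≡sg) sg<N)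
      with u , _ , Xu , Xv , Guv ← connected (lookup X) Xs Xt = begin-strict
      inducedEdges G X                  <⟨ inducedEdges-delete-< simple regular X Xu Xv Guv ⟩
      d + inducedEdges G (delete X u)   ≤⟨ +-monoʳ-≤ d (inducedEdges≤maxEdges G (delete X u)) ⟩
      d + maxEdges G ∣ delete X u ∣
        ≡⟨ cong (λ k → d + maxEdges G k) (suc-injective (trans (sym (∣delete∣ X Xu)) ∣X∣≡sg)) ⟩
      d + maxEdges G g                  ∎
      where open ≤-Reasoning

data Block (m n : ℕ) : Fin (m + n) → Set where
  left  : (a : Fin m) → Block m n (a ↑ˡ n)
  right : (b : Fin n) → Block m n (m ↑ʳ b)

block : ∀ m n (u : Fin (m + n)) → Block m n u
block m n u with splitAt m u in eq
... | inj₁ a = subst (Block m n) (Fin.splitAt⁻¹-↑ˡ eq) (left a)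
... | inj₂ b = subst (Block m n) (Fin.splitAt⁻¹-↑ʳ eq) (right b)

IsSimple-resp : ∀ {N} {A B : Graph N} → (∀ u v → A u v ≡ B u v) → IsSimple B → IsSimple A
IsSimple-resp A≗B simple = record
  { loopless  = λ u → trans (A≗B u u) (IsSimple.loopless simple u)
  ; symmetric = λ u v → trans (A≗B u v) (trans (IsSimple.symmetric simple u v) (sym (A≗B v u)))
  }

Regular-resp : ∀ {N d} {A B : Graph N} → (∀ u v → A u v ≡ B u v) → Regular d B → Regular d A
Regular-resp A≗B regular u = trans (sum-cong-≗ (λ v → cong 𝟙 (A≗B u v))) (regular u)

Connected-resp : ∀ {N} {A B : Graph N} → (∀ u v → A u v ≡ B u v) → Connected B → Connected A
Connected-resp A≗B connected S Ss St =
  let u , v , Su , Sv , Buv = connected S Ss St in u , v , Su , Sv , trans (A≗B u v) Buv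

K1-simple : IsSimple K1
K1-simple = record { loopless = λ _ → refl ; symmetric = λ _ _ → refl }

K1-regular : Regular 0 K1
K1-regular _ = refl

K1-connected : Connected K1
K1-connected S {zero} {zero} Ss St with trans (sym Ss) St
... | ()

module _ {m} {G H : Graph m} (π : Permutation′ m) where

  joinHL-↑ˡ↑ˡ : ∀ a b → joinHL G H π (a ↑ˡ m) (b ↑ˡ m) ≡ G a b
  joinHL-↑ˡ↑ˡ a b rewrite Fin.splitAt-↑ˡ m a m | Fin.splitAt-↑ˡ m b m = refl

  joinHL-↑ˡ↑ʳ : ∀ a b → joinHL G H π (a ↑ˡ m) (m ↑ʳ b) ≡ does ((π ⟨$⟩ʳ a) ≟ b)
  joinHL-↑ˡ↑ʳ a b rewrite Fin.splitAt-↑ˡ m a m | Fin.splitAt-↑ʳ m m b = refl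

  joinHL-↑ʳ↑ˡ : ∀ a b → joinHL G H π (m ↑ʳ a) (b ↑ˡ m) ≡ does ((π ⟨$⟩ʳ b) ≟ a)
  joinHL-↑ʳ↑ˡ a b rewrite Fin.splitAt-↑ʳ m m a | Fin.splitAt-↑ˡ m b m = refl

  joinHL-↑ʳ↑ʳ : ∀ a b → joinHL G H π (m ↑ʳ a) (m ↑ʳ b) ≡ H a b
  joinHL-↑ʳ↑ʳ a b rewrite Fin.splitAt-↑ʳ m m a | Fin.splitAt-↑ʳ m m b = refl

  joinHL-simple : IsSimple G → IsSimple H → IsSimple (joinHL G H π)
  joinHL-simple simpleG simpleH = record { loopless = loopless ; symmetric = symmetric }
    where
    loopless : ∀ u → joinHL G H π u u ≡ false
    loopless u with splitAt m u
    ... | inj₁ a = IsSimple.loopless simpleG a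
    ... | inj₂ b = IsSimple.loopless simpleH b
    symmetric : ∀ u v → joinHL G H π u v ≡ joinHL G H π v u
    symmetric u v with splitAt m u | splitAt m v
    ... | inj₁ a | inj₁ b = IsSimple.symmetric simpleG a b
    ... | inj₁ a | inj₂ b = refl
    ... | inj₂ a | inj₁ b = refl
    ... | inj₂ a | inj₂ b = IsSimple.symmetric simpleH a b

  joinHL-regular : ∀ {d} → Regular d G → Regular d H → Regular (suc d) (joinHL G H π)
  joinHL-regular {d} regularG regularH u with block m m u
  ... | left a = begin
    count (joinHL G H π (a ↑ˡ m))                                 ≡⟨ ∑-↑ˡ↑ʳ m m _ ⟩
    count (λ b → joinHL G H π (a ↑ˡ m) (b ↑ˡ m)) + count (λ b → joinHL G H π (a ↑ˡ m) (m ↑ʳ b))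
      ≡⟨ cong₂ _+_ (sum-cong-≗ (cong 𝟙 ∘ joinHL-↑ˡ↑ˡ a)) (sum-cong-≗ (cong 𝟙 ∘ joinHL-↑ˡ↑ʳ a)) ⟩
    count (G a) + count (λ b → does ((π ⟨$⟩ʳ a) ≟ b))            ≡⟨ cong₂ _+_ (regularG a) (count-≟ʳ (π ⟨$⟩ʳ a)) ⟩
    d + 1                                                         ≡⟨ +-comm d 1 ⟩
    suc d                                                         ∎
    where open ≡-Reasoning
  ... | right b = begin
    count (joinHL G H π (m ↑ʳ b))                                 ≡⟨ ∑-↑ˡ↑ʳ m m _ ⟩
    count (λ a → joinHL G H π (m ↑ʳ b) (a ↑ˡ m)) + count (λ a → joinHL G H π (m ↑ʳ b) (m ↑ʳ a))
      ≡⟨ cong₂ _+_ (sum-cong-≗ (cong 𝟙 ∘ joinHL-↑ʳ↑ˡ b)) (sum-cong-≗ (cong 𝟙 ∘ joinHL-↑ʳ↑ʳ b)) ⟩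
    count (λ a → does ((π ⟨$⟩ʳ a) ≟ b)) + count (H b)
      ≡⟨ cong (_+ count (H b)) (sym (∑-permute (λ c → 𝟙 (does (c ≟ b))) π)) ⟩
    count (λ c → does (c ≟ b)) + count (H b)                      ≡⟨ cong₂ _+_ (count-at (λ _ → true) b refl) (regularH b) ⟩
    suc d                                                         ∎
    where open ≡-Reasoning

  joinHL-connected : Connected G → Connected (joinHL G H π)
  joinHL-connected connected S {s} {t} Ss St with Fin.all? (λ a → S (a ↑ˡ m) Bool.≟ S (m ↑ʳ (π ⟨$⟩ʳ a)))
  ... | no disagree = matching-edge (Fin.¬∀⟶∃¬ m _ (λ a → S (a ↑ˡ m) Bool.≟ S (m ↑ʳ (π ⟨$⟩ʳ a))) disagree)
    where
    matched : ∀ a → does ((π ⟨$⟩ʳ a) ≟ (π ⟨$⟩ʳ a)) ≡ true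
    matched a = dec-true ((π ⟨$⟩ʳ a) ≟ (π ⟨$⟩ʳ a)) refl
    matching-edge : (∃ λ a → S (a ↑ˡ m) ≢ S (m ↑ʳ (π ⟨$⟩ʳ a))) →
      ∃₂ λ u v → S u ≡ true × S v ≡ false × joinHL G H π u v ≡ true
    matching-edge (a , S≢) with S (a ↑ˡ m) in Sa | S (m ↑ʳ (π ⟨$⟩ʳ a)) in Sπa
    ... | true  | false = _ , _ , Sa , Sπa , trans (joinHL-↑ˡ↑ʳ a _) (matched a)
    ... | false | true  = _ , _ , Sπa , Sa , trans (joinHL-↑ʳ↑ˡ _ a) (matched a)
    ... | true  | true  = contradiction refl S≢
    ... | false | false = contradiction refl S≢
  -- S is constant along the matching, so it takes both values on the left copy.
  ... | yes agree =
    let u , v , Su , Sv , Guv = connected (S ∘ (_↑ˡ m)) (trans (proj₂ (to-left s)) Ss) (trans (proj₂ (to-left t)) St)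
    in u ↑ˡ m , v ↑ˡ m , Su , Sv , trans (joinHL-↑ˡ↑ˡ u v) Guv
    where
    to-left : ∀ w → ∃ λ a → S (a ↑ˡ m) ≡ S w
    to-left w with block m m w
    ... | left a  = a , refl
    ... | right b = π ⟨$⟩ˡ b , trans (agree (π ⟨$⟩ˡ b)) (cong (λ c → S (m ↑ʳ c)) (inverseʳ π))

HL-simple : ∀ {n G} → HL n G → IsSimple G
HL-simple (hl0 A A≗K1)           = IsSimple-resp A≗K1 K1-simple
HL-simple (hlsuc hG hH π A A≗GH) = IsSimple-resp A≗GH (joinHL-simple π (HL-simple hG) (HL-simple hH))

HL-regular : ∀ {n G} → HL n G → Regular n G
HL-regular (hl0 A A≗K1)           = Regular-resp A≗K1 K1-regular
HL-regular (hlsuc hG hH π A A≗GH) = Regular-resp A≗GH (joinHL-regular π (HL-regular hG) (HL-regular hH))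

HL-connected : ∀ {n G} → HL n G → Connected G
HL-connected (hl0 A A≗K1)           = Connected-resp A≗K1 K1-connected
HL-connected (hlsuc hG hH π A A≗GH) = Connected-resp A≗GH (joinHL-connected π (HL-connected hG))

pow2≡2^ : ∀ n → pow2 n ≡ 2 ^ n
pow2≡2^ zero    = refl
pow2≡2^ (suc n) = trans (cong₂ _+_ (pow2≡2^ n) (pow2≡2^ n)) (cong (2 ^ n +_) (sym (+-identityʳ _)))

suc-2^⌈n/2⌉<2^n : ∀ n → 2 ≤ n → suc (2 ^ ⌈ n /2⌉) < 2 ^ n
suc-2^⌈n/2⌉<2^n (suc zero)    (s≤s ())
suc-2^⌈n/2⌉<2^n (suc (suc k)) _ = begin-strict
  suc (2 ^ ⌈ suc (suc k) /2⌉)  ≤⟨ s≤s (^-monoʳ-≤ 2 (s≤s⁻¹ (⌈n/2⌉<n k))) ⟩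
  suc (2 ^ suc k)              <⟨ +-monoˡ-< (2 ^ suc k) (*-monoʳ-≤ 2 (m^n>0 2 k)) ⟩
  2 ^ suc k + 2 ^ suc k        ≡⟨ cong (2 ^ suc k +_) (sym (+-identityʳ _)) ⟩
  2 ^ suc (suc k)              ∎
  where open ≤-Reasoning

lemma3p1 : (n : ℕ) → 2 ≤ n → (G : Graph (pow2 n)) → HL n G →
    ((g : ℕ) (X : Subset (pow2 n)) → ∣ X ∣ ≡ g →
      n * g ≤ boundary G X + 2 * maxEdges G g)
    × ((g : ℕ) → 1 ≤ g → g ≤ 2 ^ ⌈ n /2⌉ →
      n * g + maxEdges G (suc g) < n * (suc g) + maxEdges G g)
lemma3p1 n 2≤n G hl = boundary-bound , maxEdges-increment
  where
  boundary-bound : (g : ℕ) (X : Subset (pow2 n)) → ∣ X ∣ ≡ g → n * g ≤ boundary G X + 2 * maxEdges G g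
  boundary-bound _ X refl = boundary+maxEdges-≥ (HL-simple hl) (HL-regular hl) X
  maxEdges-increment : (g : ℕ) → 1 ≤ g → g ≤ 2 ^ ⌈ n /2⌉ → n * g + maxEdges G (suc g) < n * suc g + maxEdges G g
  maxEdges-increment g _ g≤ = begin-strict
    n * g + maxEdges G (suc g)     <⟨ +-monoʳ-< (n * g) increment ⟩
    n * g + (n + maxEdges G g)     ≡⟨ regroup n g (maxEdges G g) ⟩
    n * suc g + maxEdges G g       ∎
    where
    open ≤-Reasoning
    sg<N : suc g < pow2 n
    sg<N = subst (suc g <_) (sym (pow2≡2^ n)) (≤-<-trans (s≤s g≤) (suc-2^⌈n/2⌉<2^n n 2≤n))
    increment : maxEdges G (suc g) < n + maxEdges G g
    increment = maxEdges-suc-< (HL-simple hl) (HL-regular hl) (HL-connected hl) (≤-trans (s≤s z≤n) 2≤n) sg<N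
    regroup : ∀ n g e → n * g + (n + e) ≡ n * suc g + e
    regroup = solve-∀
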